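{- Let $r \ge 2$ and $\delta \in (0,1)$. For every $N$ there exists an $r$-edge-coloured graph $G$ with $|V(G)|\ge N$, $\delta(G) \ge (1-\delta)|V(G)|$ and \[ tc(G) \ge \frac{r}{120}\left\lceil \frac{r}{\log(1/\delta)}\right\rceil. \]
   Context: An $r$-edge-coloured graph is a simple graph with a colouring of its edges by $[r]$; $\delta(G)$ is its minimum (uncoloured) degree. A monochromatic tree is a tree subgraph with all edges of one colour (single vertices allowed), and $tc(G)$ is the minimum number of monochromatic trees (not necessarily disjoint) whose vertex sets cover $V(G)$. Logarithms are natural.
   Formalization: The parameter δ ranges over the rationals in the interval (0,1). -}

module Defs where

open import Data.Nat as ℕ using (ℕ; zero; suc; _∸_; _!)
open import Data.Nat.Properties using (_!≢0)
open import Data.Integer as ℤ using (ℤ)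
open import Data.Rational as ℚ using (ℚ; 0ℚ; 1ℚ)
open import Data.Fin using (Fin; toℕ; inject₁) renaming (suc to fsuc)
open import Data.Maybe using (Maybe; just; nothing; is-just)
open import Data.Bool using (if_then_else_)
open import Data.List using (List; map; allFin)
open import Data.Nat.ListAction using (sum)
open import Data.List.Relation.Unary.Any using (Any)
open import Data.Product using (Σ; ∃; _×_)
open import Function.Definitions using (Injective)
open import Relation.Binary.PropositionalEquality using (_≡_)

-- An r-edge-coloured simple graph on vertex set Fin n:
-- col u v = just c  means  uv is an edge of colour c; nothing means non-edge.
record ColouredGraph (r n : ℕ) : Set where
  field
    col   : Fin n → Fin n → Maybe (Fin r)
    symm  : ∀ u v → col u v ≡ col v u
    loopless : ∀ v → col v v ≡ nothing
open ColouredGraph public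

deg : ∀ {r n} → ColouredGraph r n → Fin n → ℕ
deg {n = n} G v = sum (map (λ u → if is-just (col G v u) then 1 else 0) (allFin n))

-- A monochromatic tree of colour c: distinct vertices w 0, …, w m, where each
-- w (i+1) is joined by an edge of colour c to its parent w (par i), with
-- par i ≤ i.  (Every tree admits such an ordering; m = 0 is a single vertex.)
record MonoTree {r n : ℕ} (G : ColouredGraph r n) : Set where
  field
    colour : Fin r
    m      : ℕ
    w      : Fin (suc m) → Fin n
    w-inj  : Injective _≡_ _≡_ w
    par    : (i : Fin m) → Fin (suc m)
    par≤   : ∀ i → toℕ (par i) ℕ.≤ toℕ i
    edge   : ∀ i → col G (w (fsuc i)) (w (par i)) ≡ just colour
open MonoTree public

_∈T_ : ∀ {r n} {G : ColouredGraph r n} → Fin n → MonoTree G → Set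
v ∈T T = Σ (Fin (suc (m T))) λ i → w T i ≡ v

Covers : ∀ {r n} {G : ColouredGraph r n} → List (MonoTree G) → Set
Covers {n = n} ts = ∀ (v : Fin n) → Any (v ∈T_) ts

ℕtoℚ : ℕ → ℚ
ℕtoℚ k = ℤ.+ k ℚ./ 1

_^ℚ_ : ℚ → ℕ → ℚ
q ^ℚ zero = 1ℚ
q ^ℚ suc k = q ℚ.* (q ^ℚ k)

-- partial sums  S r M = Σ_{i<M} r^i / i!   (these increase strictly to e^r)
expPartial : ℕ → ℕ → ℚ
expPartial r zero = 0ℚ
expPartial r (suc M) =
  expPartial r M ℚ.+ (ℤ.+ (r ℕ.^ M) ℚ./ (M !)) {{M !≢0}}

-- CeilRLog r δ k  ⇔  k = ⌈ r / log(1/δ) ⌉  (for 0 < δ < 1), i.e.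
--   (k-1)·log(1/δ) < r ≤ k·log(1/δ),
-- i.e. (1/δ)^(k-1) < e^r ≤ (1/δ)^k, i.e.
--   ∃ M. 1 < S_M · δ^(k-1)   and   ∀ M. S_M · δ^k ≤ 1.
CeilRLog : ℕ → ℚ → ℕ → Set
CeilRLog r δ k =
  (∃ λ M → 1ℚ ℚ.< expPartial r M ℚ.* (δ ^ℚ (k ∸ 1)))
  × (∀ M → expPartial r M ℚ.* (δ ^ℚ k) ℚ.≤ 1ℚ)

-- Write δ = p/q and b = ⌊r/4⌋. A vertex is a triple (β, z, w): a list β of b blocked colours,
-- a label zᵢ ∈ [k] for every colour i, and a tag w ∈ [c]. Two distinct vertices are joined in
-- the first colour that is unblocked at both of them and at which their labels agree.
--
-- Any two vertices share at least s = r − 2b ≥ r/2 unblocked colours, so for a fixed vertex the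
-- proportion of vertices it is not adjacent to is at most ((k−1)/k)ˢ, which is below δ when k
-- is chosen with ((k−1)/k)ˢ < δ ≤ (k/(k+1))ˢ.  The second inequality gives δ^(k+1) ≤ 2⁻ˢ,
-- hence ⌈r / log(1/δ)⌉ ≤ 10(k+1).
--
-- Along a tree of colour i every edge joins two vertices with the same label at i, and every
-- vertex except the root is unblocked at i; so apart from its root a tree lies in one label
-- class {zᵢ = α}. Given fewer than k(b+1) trees, at most b colours carry k trees or more.
-- Blocking exactly those, choosing for each other colour i a label class that no tree of colour
-- i uses, and a tag that no root carries yields a vertex that no tree covers. As r < 4(b+1)
-- and 10(k+1) ≤ 20k, this gives r·⌈r / log(1/δ)⌉ ≤ 80·k(b+1) ≤ 80·tc(G).
module Submission where

open import Defs
open import Data.Nat hiding (_≟_)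
open import Data.Nat.Properties hiding (_≟_)
open import Data.Nat.DivMod using (m/n*n≤m; m≡m%n+[m/n]*n; m%n<n)
open import Data.Nat.ListAction using (sum; product)
open import Data.Nat.ListAction.Properties using (sum-++)
open import Data.Nat.Tactic.RingSolver using (solve-∀)
open import Data.Bool using (Bool; true; false; not; _∧_; _∨_; if_then_else_)
open import Data.Bool.Properties using (∧-comm)
open import Data.Fin using (Fin; zero; suc; toℕ; fromℕ<)
open import Data.Fin.Properties using (_≟_; pigeonhole; ¬∀⟶∃¬)
import Data.Fin.Properties as Fin
open import Data.List as List
  using (List; []; _∷_; [_]; _++_; map; length; allFin; tabulate; filter; findᵇ; cartesianProduct; cartesianProductWith)
open import Data.List.Properties using (map-++; map-∘; map-cong; length-map; length-++; length-tabulate; tabulate-lookup)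
open import Data.List.Membership.Propositional using (_∈_; _∉_; find)
open import Data.List.Membership.Propositional.Properties
  using (∈-cartesianProductWith⁺; ∈-cartesianProduct⁺; ∈-allFin; ∈-filter⁺; ∈-map⁺)
import Data.List.Membership.DecPropositional as ListDecMembership
open import Data.List.Relation.Unary.Any as Any using (Any; here)
open import Data.List.Relation.Unary.Any.Properties using (lookup-index)
open import Data.Maybe using (Maybe; just; nothing; is-just; is-nothing)
open import Data.Product using (Σ; ∃; ∃₂; _×_; _,_; proj₁; proj₂; uncurry)
open import Data.Vec as Vec using (Vec; lookup; padRight)
open import Data.Vec.Properties using (lookup∘tabulate)
import Data.Vec.Membership.Propositional as VecMembership
open import Data.Vec.Membership.Propositional.Properties using (∈-fromList⁺)
import Data.Vec.Membership.DecPropositional as VecDecMembership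
import Data.Vec.Relation.Unary.Any as VecAny
open import Data.Integer as ℤ using (-[1+_]; 1ℤ)
import Data.Integer.Properties as ℤ
open import Data.Rational as ℚ using (ℚ; 0ℚ; 1ℚ; mkℚ)
import Data.Rational.Properties as ℚ
open import Data.Rational.Unnormalised as ℚᵘ using (mkℚᵘ; *≡*; *≤*; *<*)
import Data.Rational.Unnormalised.Properties as ℚᵘ
open import Data.Rational.Solver using (module +-*-Solver)
open import Data.Empty using (⊥-elim)
open import Function using (_∘_; id)
open import Level using (Level)
open import Relation.Nullary using (¬_; Dec; does; yes; no)
open import Relation.Nullary.Decidable using (dec-true)
open import Relation.Unary using (Pred; Decidable)
open import Relation.Binary.PropositionalEquality
  using (_≡_; refl; sym; trans; cong; cong₂; subst; subst₂; module ≡-Reasoning)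

private
  variable
    A B C : Set

-- Factorials and powers

^-distrib-* : ∀ m n o → (m * n) ^ o ≡ m ^ o * n ^ o
^-distrib-* m n zero = refl
^-distrib-* m n (suc o) rewrite ^-distrib-* m n o = interchange m n (m ^ o) (n ^ o)
  where
  interchange : ∀ a b x y → a * b * (x * y) ≡ a * x * (b * y)
  interchange = solve-∀

[x^a]^b≡[x^b]^a : ∀ x a b → (x ^ a) ^ b ≡ (x ^ b) ^ a
[x^a]^b≡[x^b]^a x a b = begin-equality
  (x ^ a) ^ b    ≡⟨ ^-*-assoc x a b ⟩
  x ^ (a * b)    ≡⟨ cong (x ^_) (*-comm a b) ⟩
  x ^ (b * a)    ≡⟨ ^-*-assoc x b a ⟨
  (x ^ b) ^ a    ∎
  where open ≤-Reasoning

^*!≤[+]! : ∀ m n → m ^ n * m ! ≤ (m + n) !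
^*!≤[+]! m zero rewrite +-identityʳ m | +-identityʳ (m !) = ≤-refl
^*!≤[+]! m (suc n) = begin
  m * m ^ n * m !          ≡⟨ *-assoc m (m ^ n) (m !) ⟩
  m * (m ^ n * m !)        ≤⟨ *-mono-≤ (m≤n+m m (suc n)) (^*!≤[+]! m n) ⟩
  (suc n + m) * (m + n) !  ≡⟨ cong (λ a → suc a * (m + n) !) (+-comm n m) ⟩
  suc (m + n) !            ≡⟨ cong _! (+-suc m n) ⟨
  (m + suc n) !            ∎
  where open ≤-Reasoning

-- By Pascal's rule (m+n+2)! = (m+1)·(m+n+1)! + (n+1)·(m+n+1)!.
[+]!≤2^*!*! : ∀ m n → (m + n) ! ≤ 2 ^ (m + n) * (m ! * n !)
[+]!≤2^*!*! zero n = begin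
  n !                  ≤⟨ m≤n*m (n !) (2 ^ n) {{m^n≢0 2 n}} ⟩
  2 ^ n * n !          ≡⟨ cong (2 ^ n *_) (+-identityʳ (n !)) ⟨
  2 ^ n * (1 * n !)    ∎
  where open ≤-Reasoning
[+]!≤2^*!*! (suc m) zero = begin
  (suc m + 0) !                    ≤⟨ m≤n*m _ (2 ^ (suc m + 0)) {{m^n≢0 2 (suc m + 0)}} ⟩
  2 ^ (suc m + 0) * (suc m + 0) !  ≡⟨ cong (λ a → 2 ^ (suc m + 0) * a !) (+-identityʳ (suc m)) ⟩
  2 ^ (suc m + 0) * suc m !        ≡⟨ cong (2 ^ (suc m + 0) *_) (*-identityʳ (suc m !)) ⟨
  2 ^ (suc m + 0) * (suc m ! * 1)  ∎
  where open ≤-Reasoning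
[+]!≤2^*!*! (suc m) (suc n) = begin
  (suc m + suc n) !
    ≡⟨ cong (λ a → suc (m + suc n) * a !) (+-suc m n) ⟩
  (suc m + suc n) * (suc m + n) !
    ≡⟨ *-distribʳ-+ ((suc m + n) !) (suc m) (suc n) ⟩
  suc m * (suc m + n) ! + suc n * (suc m + n) !
    ≡⟨ cong (λ a → suc m * a ! + suc n * (suc m + n) !) (+-suc m n) ⟨
  suc m * (m + suc n) ! + suc n * (suc m + n) !
    ≤⟨ +-mono-≤ (*-monoʳ-≤ (suc m) ([+]!≤2^*!*! m (suc n))) (*-monoʳ-≤ (suc n) ([+]!≤2^*!*! (suc m) n)) ⟩
  suc m * (2 ^ (m + suc n) * (m ! * suc n !)) + suc n * (2 ^ (suc m + n) * (suc m ! * n !))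
    ≡⟨ cong (λ a → suc m * (2 ^ a * (m ! * suc n !)) + suc n * (2 ^ (suc m + n) * (suc m ! * n !))) (+-suc m n) ⟩
  suc m * (2 ^ (suc m + n) * (m ! * suc n !)) + suc n * (2 ^ (suc m + n) * (suc m ! * n !))
    ≡⟨ pascal (suc m) (suc n) (2 ^ (suc m + n)) (m !) (n !) ⟩
  2 * 2 ^ (suc m + n) * (suc m ! * suc n !)
    ≡⟨ cong (λ a → 2 * 2 ^ a * (suc m ! * suc n !)) (+-suc m n) ⟨
  2 ^ (suc m + suc n) * (suc m ! * suc n !) ∎
  where
  open ≤-Reasoning
  pascal : ∀ a b p x y → a * (p * (x * (b * y))) + b * (p * (a * x * y)) ≡ 2 * p * (a * x * (b * y))
  pascal = solve-∀

^≤!*2^ : ∀ m n → m ^ n ≤ n ! * 2 ^ (m + n)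
^≤!*2^ m n = *-cancelʳ-≤ (m ^ n) (n ! * 2 ^ (m + n)) (m !) {{m !≢0}} (begin
  m ^ n * m !                  ≤⟨ ^*!≤[+]! m n ⟩
  (m + n) !                    ≤⟨ [+]!≤2^*!*! m n ⟩
  2 ^ (m + n) * (m ! * n !)    ≡⟨ reorder (2 ^ (m + n)) (m !) (n !) ⟩
  n ! * 2 ^ (m + n) * m !      ∎)
  where
  open ≤-Reasoning
  reorder : ∀ p x y → p * (x * y) ≡ y * p * x
  reorder = solve-∀

2^*^≤2^[4*]*! : ∀ m n → 2 ^ n * m ^ n ≤ 2 ^ (4 * m) * n !
2^*^≤2^[4*]*! m n = *-cancelˡ-≤ (2 ^ n) {{m^n≢0 2 n}} (begin
  2 ^ n * (2 ^ n * m ^ n)        ≡⟨ *-assoc (2 ^ n) (2 ^ n) (m ^ n) ⟨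
  2 ^ n * 2 ^ n * m ^ n          ≡⟨ cong (_* m ^ n) (^-distrib-* 2 2 n) ⟨
  4 ^ n * m ^ n                  ≡⟨ ^-distrib-* 4 m n ⟨
  (4 * m) ^ n                    ≤⟨ ^≤!*2^ (4 * m) n ⟩
  n ! * 2 ^ (4 * m + n)          ≡⟨ cong (n ! *_) (^-distribˡ-+-* 2 (4 * m) n) ⟩
  n ! * (2 ^ (4 * m) * 2 ^ n)    ≡⟨ reorder (n !) (2 ^ (4 * m)) (2 ^ n) ⟩
  2 ^ n * (2 ^ (4 * m) * n !)    ∎)
  where
  open ≤-Reasoning
  reorder : ∀ a b c → a * (b * c) ≡ c * (b * a)
  reorder = solve-∀

binomial-lower : ∀ x n → x ^ suc n + suc n * x ^ n ≤ suc x ^ suc n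
binomial-lower x zero = ≤-reflexive (expand x)
  where
  expand : ∀ x → x * 1 + 1 * 1 ≡ (1 + x) * 1
  expand = solve-∀
binomial-lower x (suc n) = begin
  x * (x * x ^ n) + suc (suc n) * (x * x ^ n)
    ≤⟨ m≤m+n _ (suc n * x ^ n) ⟩
  x * (x * x ^ n) + suc (suc n) * (x * x ^ n) + suc n * x ^ n
    ≡⟨ factor x n (x ^ n) ⟩
  suc x * (x * x ^ n + suc n * x ^ n)
    ≤⟨ *-monoʳ-≤ (suc x) (binomial-lower x n) ⟩
  suc x * suc x ^ suc n ∎
  where
  open ≤-Reasoning
  factor : ∀ x n y → x * (x * y) + (2 + n) * (x * y) + (1 + n) * y ≡ (1 + x) * (x * y + (1 + n) * y)
  factor = solve-∀

binomial-upper : ∀ x n → suc x ^ suc n ≤ x ^ suc n + suc n * suc x ^ n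
binomial-upper x zero = ≤-reflexive (expand x)
  where
  expand : ∀ x → (1 + x) * 1 ≡ x * 1 + 1 * 1
  expand = solve-∀
binomial-upper x (suc n) = begin
  suc x * suc x ^ suc n
    ≤⟨ *-monoʳ-≤ (suc x) (binomial-upper x n) ⟩
  suc x * (x ^ suc n + suc n * suc x ^ n)
    ≡⟨ expand x (x ^ suc n) (suc n) (suc x ^ n) ⟩
  x * x ^ suc n + x ^ suc n + suc n * (suc x * suc x ^ n)
    ≤⟨ +-monoˡ-≤ _ (+-monoʳ-≤ (x * x ^ suc n) (^-monoˡ-≤ (suc n) (n≤1+n x))) ⟩
  x * x ^ suc n + suc x ^ suc n + suc n * (suc x * suc x ^ n)
    ≡⟨ +-assoc (x * x ^ suc n) _ _ ⟩
  x * x ^ suc n + suc (suc n) * suc x ^ suc n ∎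
  where
  open ≤-Reasoning
  expand : ∀ x y n z → (1 + x) * (y + n * z) ≡ x * y + y + n * ((1 + x) * z)
  expand = solve-∀

2*n^[1+n]≤[1+n]^[1+n] : ∀ n → 2 * n ^ suc n ≤ suc n ^ suc n
2*n^[1+n]≤[1+n]^[1+n] n = begin
  2 * n ^ suc n                ≡⟨⟩
  n ^ suc n + (n * n ^ n + 0)  ≡⟨ cong (n ^ suc n +_) (+-identityʳ _) ⟩
  n ^ suc n + n * n ^ n        ≤⟨ +-monoʳ-≤ (n ^ suc n) (*-monoˡ-≤ (n ^ n) (n≤1+n n)) ⟩
  n ^ suc n + suc n * n ^ n    ≤⟨ binomial-lower n n ⟩
  suc n ^ suc n                ∎
  where open ≤-Reasoning

-- If p/q ≤ (k/(k+1))ᵐ then (p/q)^(k+1) ≤ 2⁻ᵐ, because (1 + 1/k)^(k+1) ≥ 2.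
^[1+k]*2^≤^[1+k] : ∀ {p q k m} → 1 ≤ k → p * suc k ^ m ≤ q * k ^ m → p ^ suc k * 2 ^ m ≤ q ^ suc k
^[1+k]*2^≤^[1+k] {p} {q} {k} {m} 1≤k ratio =
  *-cancelʳ-≤ _ _ ((k ^ m) ^ a) {{m^n≢0 (k ^ m) a {{m^n≢0 k m {{>-nonZero 1≤k}}}}}} (begin
  p ^ a * 2 ^ m * (k ^ m) ^ a        ≡⟨ *-assoc (p ^ a) _ _ ⟩
  p ^ a * (2 ^ m * (k ^ m) ^ a)      ≡⟨ cong (λ y → p ^ a * (2 ^ m * y)) ([x^a]^b≡[x^b]^a k m a) ⟩
  p ^ a * (2 ^ m * (k ^ a) ^ m)      ≡⟨ cong (p ^ a *_) (^-distrib-* 2 (k ^ a) m) ⟨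
  p ^ a * (2 * k ^ a) ^ m            ≤⟨ *-monoʳ-≤ (p ^ a) (^-monoˡ-≤ m (2*n^[1+n]≤[1+n]^[1+n] k)) ⟩
  p ^ a * (a ^ a) ^ m                ≡⟨ cong (p ^ a *_) ([x^a]^b≡[x^b]^a a a m) ⟩
  p ^ a * (a ^ m) ^ a                ≡⟨ ^-distrib-* p (a ^ m) a ⟨
  (p * a ^ m) ^ a                    ≤⟨ ^-monoˡ-≤ a ratio ⟩
  (q * k ^ m) ^ a                    ≡⟨ ^-distrib-* q (k ^ m) a ⟩
  q ^ a * (k ^ m) ^ a                ∎)
  where
  open ≤-Reasoning
  a = suc k

^-gap-iterate : ∀ {p q a x} → p ≤ q → p ^ a * x ≤ q ^ a → ∀ t e → p ^ (t * a + e) * x ^ t ≤ q ^ (t * a + e)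
^-gap-iterate {p} {q} p≤q gap zero e = ≤-trans (≤-reflexive (*-identityʳ (p ^ e))) (^-monoˡ-≤ e p≤q)
^-gap-iterate {p} {q} {a} {x} p≤q gap (suc t) e = begin
  p ^ (a + t * a + e) * (x * x ^ t)            ≡⟨ cong (λ y → p ^ y * (x * x ^ t)) (+-assoc a (t * a) e) ⟩
  p ^ (a + (t * a + e)) * (x * x ^ t)          ≡⟨ cong (_* (x * x ^ t)) (^-distribˡ-+-* p a (t * a + e)) ⟩
  p ^ a * p ^ (t * a + e) * (x * x ^ t)        ≡⟨ interchange (p ^ a) (p ^ (t * a + e)) x (x ^ t) ⟩
  (p ^ a * x) * (p ^ (t * a + e) * x ^ t)      ≤⟨ *-mono-≤ gap (^-gap-iterate p≤q gap t e) ⟩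
  q ^ a * q ^ (t * a + e)                      ≡⟨ ^-distribˡ-+-* q a (t * a + e) ⟨
  q ^ (a + (t * a + e))                        ≡⟨ cong (q ^_) (+-assoc a (t * a) e) ⟨
  q ^ (a + t * a + e)                          ∎
  where
  open ≤-Reasoning
  interchange : ∀ a b c d → a * b * (c * d) ≡ (a * c) * (b * d)
  interchange = solve-∀

p*[1+x]^m≤q*x^m : ∀ {p q m x} → p < q → q * m ≤ x → 1 ≤ m → p * suc x ^ m ≤ q * x ^ m
p*[1+x]^m≤q*x^m {p} {q} {suc m} {x} p<q qm≤x _ =
  +-cancelʳ-≤ (suc x ^ suc m) (p * suc x ^ suc m) (q * x ^ suc m) (begin
  p * X + X                     ≡⟨ +-comm (p * X) X ⟩
  suc p * X                     ≤⟨ *-monoˡ-≤ X p<q ⟩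
  q * X                         ≤⟨ *-monoʳ-≤ q (binomial-upper x m) ⟩
  q * (x ^ suc m + suc m * Y)   ≡⟨ distrib q (x ^ suc m) (suc m) Y ⟩
  q * x ^ suc m + q * suc m * Y ≤⟨ +-monoʳ-≤ (q * x ^ suc m) (*-monoˡ-≤ Y (≤-trans qm≤x (n≤1+n x))) ⟩
  q * x ^ suc m + X             ∎)
  where
  open ≤-Reasoning
  X = suc x ^ suc m
  Y = suc x ^ m
  distrib : ∀ q a m y → q * (a + m * y) ≡ q * a + q * m * y
  distrib = solve-∀

module _ {ℓ : Level} {P : Pred ℕ ℓ} (P? : Decidable P) where

  crossing : ∀ d a → P a → (∀ x → a + d ≤ x → ¬ P x) → ∃ λ k → a ≤ k × P k × ¬ P (suc k)
  crossing d a Pa eventually¬P with P? (suc a)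
  ... | no ¬Pa+1 = a , ≤-refl , Pa , ¬Pa+1
  crossing zero a Pa eventually¬P | yes Pa+1 =
    ⊥-elim (eventually¬P (suc a) (≤-trans (≤-reflexive (+-identityʳ a)) (n≤1+n a)) Pa+1)
  crossing (suc d) a Pa eventually¬P | yes Pa+1
    with k , a+1≤k , Pk , ¬Pk+1 ← crossing d (suc a) Pa+1 (λ x le → eventually¬P x (≤-trans (≤-reflexive (+-suc a d)) le))
    = k , ≤-trans (n≤1+n a) a+1≤k , Pk , ¬Pk+1

-- Finite sums and enumerations

indicator : Bool → ℕ
indicator b = if b then 1 else 0

indicator-∨ : ∀ a b → indicator (a ∨ b) ≤ indicator a + indicator b
indicator-∨ true b = s≤s z≤n
indicator-∨ false b = ≤-refl

indicator-+-not : ∀ a → indicator a + indicator (not a) ≡ 1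
indicator-+-not true = refl
indicator-+-not false = refl

sum-map-+ : ∀ (f g : A → ℕ) xs → sum (map (λ x → f x + g x) xs) ≡ sum (map f xs) + sum (map g xs)
sum-map-+ f g [] = refl
sum-map-+ f g (x ∷ xs) rewrite sum-map-+ f g xs = +-+-interchange (f x) (g x) (sum (map f xs)) (sum (map g xs))
  where
  +-+-interchange : ∀ a b c d → a + b + (c + d) ≡ a + c + (b + d)
  +-+-interchange = solve-∀

sum-map-*ˡ : ∀ c (f : A → ℕ) xs → sum (map (λ x → c * f x) xs) ≡ c * sum (map f xs)
sum-map-*ˡ c f [] = sym (*-zeroʳ c)
sum-map-*ˡ c f (x ∷ xs) rewrite sum-map-*ˡ c f xs = sym (*-distribˡ-+ c (f x) (sum (map f xs)))

sum-map-cong : ∀ {f g : A → ℕ} → (∀ x → f x ≡ g x) → ∀ xs → sum (map f xs) ≡ sum (map g xs)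
sum-map-cong f≗g xs = cong sum (map-cong f≗g xs)

sum-map-*ʳ : ∀ c (f : A → ℕ) xs → sum (map (λ x → f x * c) xs) ≡ sum (map f xs) * c
sum-map-*ʳ c f xs = begin-equality
  sum (map (λ x → f x * c) xs)   ≡⟨ sum-map-cong (λ x → *-comm (f x) c) xs ⟩
  sum (map (λ x → c * f x) xs)   ≡⟨ sum-map-*ˡ c f xs ⟩
  c * sum (map f xs)             ≡⟨ *-comm c _ ⟩
  sum (map f xs) * c             ∎
  where open ≤-Reasoning

sum-map-const : ∀ c (xs : List A) → sum (map (λ _ → c) xs) ≡ length xs * c
sum-map-const c [] = refl
sum-map-const c (x ∷ xs) = cong (c +_) (sum-map-const c xs)

sum-map-zero : ∀ (xs : List A) → sum (map (λ _ → 0) xs) ≡ 0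
sum-map-zero [] = refl
sum-map-zero (x ∷ xs) = sum-map-zero xs

sum-map-mono : ∀ {f g : A → ℕ} → (∀ x → f x ≤ g x) → ∀ xs → sum (map f xs) ≤ sum (map g xs)
sum-map-mono f≤g [] = z≤n
sum-map-mono f≤g (x ∷ xs) = +-mono-≤ (f≤g x) (sum-map-mono f≤g xs)

sum-map-cartesianProductWith : ∀ (g : A → B → C) (h : C → ℕ) xs ys →
  sum (map h (cartesianProductWith g xs ys)) ≡ sum (map (λ x → sum (map (λ y → h (g x y)) ys)) xs)
sum-map-cartesianProductWith g h [] ys = refl
sum-map-cartesianProductWith g h (x ∷ xs) ys = begin-equality
  sum (map h (map (g x) ys ++ cartesianProductWith g xs ys))
    ≡⟨ cong sum (map-++ h (map (g x) ys) _) ⟩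
  sum (map h (map (g x) ys) ++ map h (cartesianProductWith g xs ys))
    ≡⟨ sum-++ (map h (map (g x) ys)) _ ⟩
  sum (map h (map (g x) ys)) + sum (map h (cartesianProductWith g xs ys))
    ≡⟨ cong₂ _+_ (sym (cong sum (map-∘ ys))) (sum-map-cartesianProductWith g h xs ys) ⟩
  sum (map (λ y → h (g x y)) ys) + sum (map (λ x → sum (map (λ y → h (g x y)) ys)) xs) ∎
  where open ≤-Reasoning

length-cartesianProductWith : ∀ (f : A → B → C) xs ys → length (cartesianProductWith f xs ys) ≡ length xs * length ys
length-cartesianProductWith f [] ys = refl
length-cartesianProductWith f (x ∷ xs) ys = begin-equality
  length (map (f x) ys ++ cartesianProductWith f xs ys)
    ≡⟨ length-++ (map (f x) ys) ⟩
  length (map (f x) ys) + length (cartesianProductWith f xs ys)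
    ≡⟨ cong₂ _+_ (length-map (f x) ys) (length-cartesianProductWith f xs ys) ⟩
  length ys + length xs * length ys ∎
  where open ≤-Reasoning

map-tabulate : ∀ {n} (g : Fin n → A) (f : A → B) → map f (tabulate g) ≡ tabulate (f ∘ g)
map-tabulate {n = zero} g f = refl
map-tabulate {n = suc n} g f = cong (f (g zero) ∷_) (map-tabulate (g ∘ suc) f)

map-allFin-suc : ∀ {n} (f : Fin (suc n) → A) → map f (allFin (suc n)) ≡ f zero ∷ map (f ∘ suc) (allFin n)
map-allFin-suc f = cong (f zero ∷_) (trans (map-tabulate suc f) (sym (map-tabulate id (f ∘ suc))))

length-allFin : ∀ n → length (allFin n) ≡ n
length-allFin n = length-tabulate id

sum-ones-allFin : ∀ n → sum (map (λ _ → 1) (allFin n)) ≡ n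
sum-ones-allFin n = trans (sum-map-const 1 (allFin n)) (trans (*-identityʳ _) (length-allFin n))

sum-indicator-≟ : ∀ {n} (i : Fin n) → sum (map (λ j → indicator (does (i ≟ j))) (allFin n)) ≡ 1
sum-indicator-≟ {suc n} zero =
  trans (cong sum (map-allFin-suc {n = n} (λ j → indicator (does (zero ≟ j))))) (cong suc (sum-map-zero (allFin n)))
sum-indicator-≟ {suc n} (suc i) =
  trans (cong sum (map-allFin-suc {n = n} (λ j → indicator (does (suc i ≟ j))))) (sum-indicator-≟ i)

sum-map-lookup : ∀ (f : A → ℕ) xs → sum (map (f ∘ List.lookup xs) (allFin (length xs))) ≡ sum (map f xs)
sum-map-lookup f xs = cong sum (begin
  map (f ∘ List.lookup xs) (allFin (length xs))   ≡⟨ map-∘ (allFin (length xs)) ⟩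
  map f (map (List.lookup xs) (tabulate id))      ≡⟨ cong (map f) (map-tabulate id (List.lookup xs)) ⟩
  map f (tabulate (List.lookup xs))               ≡⟨ cong (map f) (tabulate-lookup xs) ⟩
  map f xs                                        ∎)
  where open ≡-Reasoning

length-filter-∷ : ∀ {ℓ} {P : Pred A ℓ} (P? : Decidable P) x xs →
  length (filter P? (x ∷ xs)) ≡ indicator (does (P? x)) + length (filter P? xs)
length-filter-∷ P? x xs with P? x
... | yes _ = refl
... | no _ = refl

length-filter-*≤sum : ∀ {ℓ} {P : Pred A ℓ} (P? : Decidable P) (t : A → ℕ) k →
  (∀ x → P x → k ≤ t x) → ∀ xs → length (filter P? xs) * k ≤ sum (map t xs)
length-filter-*≤sum P? t k big [] = z≤n
length-filter-*≤sum P? t k big (x ∷ xs) with P? x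
... | yes Px = +-mono-≤ (big x Px) (length-filter-*≤sum P? t k big xs)
... | no _ = ≤-trans (length-filter-*≤sum P? t k big xs) (m≤n+m _ (t x))

sum-length-fibres : ∀ {n} (f : A → Fin n) xs → sum (map (λ i → length (filter (λ x → f x ≟ i) xs)) (allFin n)) ≡ length xs
sum-length-fibres {n = n} f [] = sum-map-zero (allFin n)
sum-length-fibres {n = n} f (x ∷ xs) = begin-equality
  sum (map (λ i → length (filter (λ x → f x ≟ i) (x ∷ xs))) (allFin n))
    ≡⟨ sum-map-cong (λ i → length-filter-∷ (λ x → f x ≟ i) x xs) (allFin n) ⟩
  sum (map (λ i → I i + F i) (allFin n))
    ≡⟨ sum-map-+ I F (allFin n) ⟩
  sum (map I (allFin n)) + sum (map F (allFin n))
    ≡⟨ cong₂ _+_ (sum-indicator-≟ (f x)) (sum-length-fibres f xs) ⟩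
  suc (length xs) ∎
  where
  open ≤-Reasoning
  I F : Fin n → ℕ
  I i = indicator (does (f x ≟ i))
  F i = length (filter (λ x → f x ≟ i) xs)

product-map-allFin-suc : ∀ {n} (f : Fin (suc n) → ℕ) → product (map f (allFin (suc n))) ≡ f zero * product (map (f ∘ suc) (allFin n))
product-map-allFin-suc f = cong product (map-allFin-suc f)

vectors : List A → (n : ℕ) → List (Vec A n)
vectors xs zero = [ Vec.[] ]
vectors xs (suc n) = cartesianProductWith Vec._∷_ xs (vectors xs n)

length-vectors : ∀ (xs : List A) n → length (vectors xs n) ≡ length xs ^ n
length-vectors xs zero = refl
length-vectors xs (suc n) = trans (length-cartesianProductWith Vec._∷_ xs (vectors xs n)) (cong (length xs *_) (length-vectors xs n))

∈-vectors : ∀ {xs : List A} {n} → (∀ x → x ∈ xs) → (v : Vec A n) → v ∈ vectors xs n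
∈-vectors complete Vec.[] = here refl
∈-vectors complete (x Vec.∷ v) = ∈-cartesianProductWith⁺ Vec._∷_ (complete x) (∈-vectors complete v)

sum-vectors-product : ∀ {L} (g : Fin L → A → ℕ) xs →
  sum (map (λ v → product (map (λ i → g i (lookup v i)) (allFin L))) (vectors xs L))
    ≡ product (map (λ i → sum (map (g i) xs)) (allFin L))
sum-vectors-product {L = zero} g xs = refl
sum-vectors-product {L = suc L} g xs = begin-equality
  sum (map (λ v → product (map (λ i → g i (lookup v i)) (allFin (suc L)))) (vectors xs (suc L)))
    ≡⟨ sum-map-cartesianProductWith Vec._∷_ _ xs (vectors xs L) ⟩
  sum (map (λ a → sum (map (λ v → product (map (λ i → g i (lookup (a Vec.∷ v) i)) (allFin (suc L)))) (vectors xs L))) xs)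
    ≡⟨ sum-map-cong (λ a → sum-map-cong (λ v → product-map-allFin-suc (λ i → g i (lookup (a Vec.∷ v) i))) (vectors xs L)) xs ⟩
  sum (map (λ a → sum (map (λ v → g zero a * Π v) (vectors xs L))) xs)
    ≡⟨ sum-map-cong (λ a → sum-map-*ˡ (g zero a) Π (vectors xs L)) xs ⟩
  sum (map (λ a → g zero a * sum (map Π (vectors xs L))) xs)
    ≡⟨ sum-map-cong (λ a → cong (g zero a *_) (sum-vectors-product (g ∘ suc) xs)) xs ⟩
  sum (map (λ a → g zero a * product (map (λ i → sum (map (g (suc i)) xs)) (allFin L))) xs)
    ≡⟨ sum-map-*ʳ _ (g zero) xs ⟩
  sum (map (g zero) xs) * product (map (λ i → sum (map (g (suc i)) xs)) (allFin L))
    ≡⟨ product-map-allFin-suc (λ i → sum (map (g i) xs)) ⟨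
  product (map (λ i → sum (map (g i) xs)) (allFin (suc L))) ∎
  where
  open ≤-Reasoning
  Π : Vec _ L → ℕ
  Π v = product (map (λ i → g (suc i) (lookup v i)) (allFin L))

product-choices-bound : ∀ k m (s : A → Bool) xs → m ≤ sum (map (indicator ∘ s) xs) →
  product (map (λ x → if s x then k ∸ 1 else k) xs) * k ^ m ≤ (k ∸ 1) ^ m * k ^ length xs
product-choices-bound k zero s [] _ = ≤-refl
product-choices-bound k m s (x ∷ xs) m≤ with s x
product-choices-bound k zero s (x ∷ xs) _ | true = begin
  (k ∸ 1) * P * 1          ≡⟨ *-identityʳ _ ⟩
  (k ∸ 1) * P              ≤⟨ *-mono-≤ (m∸n≤m k 1) (≤-trans (≤-reflexive (sym (*-identityʳ P)))
                                (≤-trans (product-choices-bound k zero s xs z≤n) (≤-reflexive (*-identityˡ _)))) ⟩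
  k * k ^ length xs        ≡⟨ *-identityˡ _ ⟨
  1 * (k * k ^ length xs)  ∎
  where
  open ≤-Reasoning
  P = product (map (λ x → if s x then k ∸ 1 else k) xs)
product-choices-bound k (suc m) s (x ∷ xs) (s≤s m≤) | true = begin
  (k ∸ 1) * P * (k * k ^ m)                        ≡⟨ regroup (k ∸ 1) P k (k ^ m) ⟩
  ((k ∸ 1) * k) * (P * k ^ m)                      ≤⟨ *-monoʳ-≤ ((k ∸ 1) * k) (product-choices-bound k m s xs m≤) ⟩
  ((k ∸ 1) * k) * ((k ∸ 1) ^ m * k ^ length xs)    ≡⟨ regroup′ (k ∸ 1) k ((k ∸ 1) ^ m) (k ^ length xs) ⟩
  (k ∸ 1) * (k ∸ 1) ^ m * (k * k ^ length xs)      ∎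
  where
  open ≤-Reasoning
  P = product (map (λ x → if s x then k ∸ 1 else k) xs)
  regroup : ∀ a p b c → a * p * (b * c) ≡ (a * b) * (p * c)
  regroup = solve-∀
  regroup′ : ∀ a b c d → (a * b) * (c * d) ≡ a * c * (b * d)
  regroup′ = solve-∀
product-choices-bound k m s (x ∷ xs) m≤ | false = begin
  k * P * k ^ m                        ≡⟨ *-assoc k P (k ^ m) ⟩
  k * (P * k ^ m)                      ≤⟨ *-monoʳ-≤ k (product-choices-bound k m s xs m≤) ⟩
  k * ((k ∸ 1) ^ m * k ^ length xs)    ≡⟨ x*[y*z]≡y*[x*z] k ((k ∸ 1) ^ m) (k ^ length xs) ⟩
  (k ∸ 1) ^ m * (k * k ^ length xs)    ∎
  where
  open ≤-Reasoning
  P = product (map (λ x → if s x then k ∸ 1 else k) xs)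
  x*[y*z]≡y*[x*z] : ∀ x y z → x * (y * z) ≡ y * (x * z)
  x*[y*z]≡y*[x*z] = solve-∀

findᵇ-just : ∀ (p : A → Bool) xs {x} → findᵇ p xs ≡ just x → p x ≡ true
findᵇ-just p (y ∷ xs) eq with p y in py
findᵇ-just p (y ∷ xs) refl | true = py
... | false = findᵇ-just p xs eq

findᵇ-cong : ∀ {p q : A → Bool} → (∀ x → p x ≡ q x) → ∀ xs → findᵇ p xs ≡ findᵇ q xs
findᵇ-cong p≗q [] = refl
findᵇ-cong p≗q (x ∷ xs) rewrite p≗q x | findᵇ-cong p≗q xs = refl

indicator-findᵇ-nothing : ∀ (p : A → Bool) xs → indicator (is-nothing (findᵇ p xs)) ≡ product (map (indicator ∘ not ∘ p) xs)
indicator-findᵇ-nothing p [] = refl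
indicator-findᵇ-nothing p (x ∷ xs) with p x
... | true = refl
... | false = trans (indicator-findᵇ-nothing p xs) (sym (+-identityʳ _))

does-≟-sym : ∀ {n} (i j : Fin n) → does (i ≟ j) ≡ does (j ≟ i)
does-≟-sym i j with i ≟ j | j ≟ i
... | yes _ | yes _ = refl
... | no _ | no _ = refl
... | yes i≡j | no j≢i = ⊥-elim (j≢i (sym i≡j))
... | no i≢j | yes j≡i = ⊥-elim (i≢j (sym j≡i))

-- Otherwise a ↦ (position of a in xs) would be an injection Fin k → Fin (length xs).
∃∉-short-list : ∀ {k} (xs : List (Fin k)) → length xs < k → ∃ λ a → a ∉ xs
∃∉-short-list {k} xs short = ¬∀⟶∃¬ k (_∈ xs) (_∈? xs) not-all∈
  where
  open ListDecMembership (_≟_ {k}) using (_∈?_)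
  not-all∈ : ¬ (∀ a → a ∈ xs)
  not-all∈ complete with i , j , i<j , same-index ← pigeonhole short (Any.index ∘ complete) =
    Fin.<⇒≢ i<j (trans (lookup-index (complete i)) (trans (cong (List.lookup xs) same-index) (sym (lookup-index (complete j)))))

∈-padRight : ∀ {x : A} {m l} {xs : Vec A m} (m≤l : m ≤ l) d → x VecMembership.∈ xs → x VecMembership.∈ padRight m≤l d xs
∈-padRight (s≤s m≤l) d (VecAny.here refl) = VecAny.here refl
∈-padRight (s≤s m≤l) d (VecAny.there x∈xs) = VecAny.there (∈-padRight m≤l d x∈xs)

-- The graph

module Graph (r b k c : ℕ) where

  open VecDecMembership (_≟_ {r}) using (_∈?_)

  record Vertex : Set where
    constructor vertex
    field
      blocked : Vec (Fin r) b
      label   : Vec (Fin k) r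
      tag     : Fin c
  open Vertex

  activeFor : Vec (Fin r) b → Fin r → Bool
  activeFor β i = not (does (i ∈? β))

  active : Vertex → Fin r → Bool
  active x = activeFor (blocked x)

  shared : Vertex → Vec (Fin r) b → Fin r → Bool
  shared x β i = active x i ∧ activeFor β i

  agree : Vertex → Vertex → Fin r → Bool
  agree x y i = shared x (blocked y) i ∧ does (lookup (label x) i ≟ lookup (label y) i)

  agree-sym : ∀ x y i → agree x y i ≡ agree y x i
  agree-sym x y i = cong₂ _∧_ (∧-comm (active x i) (active y i)) (does-≟-sym (lookup (label x) i) (lookup (label y) i))

  edgeColour : Vertex → Vertex → Maybe (Fin r)
  edgeColour x y = findᵇ (agree x y) (allFin r)

  vertices : List Vertex
  vertices = cartesianProductWith (λ β → uncurry (vertex β))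
    (vectors (allFin r) b) (cartesianProduct (vectors (allFin k) r) (allFin c))

  n : ℕ
  n = length vertices

  n≡ : n ≡ r ^ b * (k ^ r * c)
  n≡ = begin-equality
    n
      ≡⟨ length-cartesianProductWith _ (vectors (allFin r) b) _ ⟩
    length (vectors (allFin r) b) * length (cartesianProduct (vectors (allFin k) r) (allFin c))
      ≡⟨ cong₂ _*_ (length-vectors (allFin r) b) (length-cartesianProductWith _,_ (vectors (allFin k) r) (allFin c)) ⟩
    length (allFin r) ^ b * (length (vectors (allFin k) r) * length (allFin c))
      ≡⟨ cong₂ (λ x y → x ^ b * y) (length-allFin r) (cong₂ _*_ (length-vectors (allFin k) r) (length-allFin c)) ⟩
    r ^ b * (length (allFin k) ^ r * c)
      ≡⟨ cong (λ x → r ^ b * (x ^ r * c)) (length-allFin k) ⟩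
    r ^ b * (k ^ r * c) ∎
    where open ≤-Reasoning

  ∈-vertices : ∀ x → x ∈ vertices
  ∈-vertices (vertex β z w) =
    ∈-cartesianProductWith⁺ _ (∈-vectors ∈-allFin β) (∈-cartesianProduct⁺ (∈-vectors ∈-allFin z) (∈-allFin w))

  vertexAt : Fin n → Vertex
  vertexAt = List.lookup vertices

  colouring : Fin n → Fin n → Maybe (Fin r)
  colouring u v = if does (u ≟ v) then nothing else edgeColour (vertexAt u) (vertexAt v)

  colouring-sym : ∀ u v → colouring u v ≡ colouring v u
  colouring-sym u v rewrite does-≟-sym u v | findᵇ-cong (agree-sym (vertexAt u) (vertexAt v)) (allFin r) = refl

  colouring-loopless : ∀ v → colouring v v ≡ nothing
  colouring-loopless v rewrite dec-true (v ≟ v) refl = refl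

  G : ColouredGraph r n
  G = record { col = colouring ; symm = colouring-sym ; loopless = colouring-loopless }

  nonNeighbours : Vertex → ℕ
  nonNeighbours x = sum (map (λ y → indicator (is-nothing (edgeColour x y))) vertices)

  n≤deg+1+nonNeighbours : ∀ v → n ≤ deg G v + (1 + nonNeighbours (vertexAt v))
  n≤deg+1+nonNeighbours v = begin
    n
      ≡⟨ sum-ones-allFin n ⟨
    sum (map (λ _ → 1) (allFin n))
      ≤⟨ sum-map-mono (λ u → edge-or-equal-or-disjoint (does (v ≟ u)) (edgeColour x (vertexAt u))) (allFin n) ⟩
    sum (map (λ u → E u + (I u + D u)) (allFin n))
      ≡⟨ sum-map-+ E (λ u → I u + D u) (allFin n) ⟩
    deg G v + sum (map (λ u → I u + D u) (allFin n))
      ≡⟨ cong (deg G v +_) (sum-map-+ I D (allFin n)) ⟩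
    deg G v + (sum (map I (allFin n)) + sum (map D (allFin n)))
      ≡⟨ cong (deg G v +_) (cong₂ _+_ (sum-indicator-≟ v) (sum-map-lookup (λ y → indicator (is-nothing (edgeColour x y))) vertices)) ⟩
    deg G v + (1 + nonNeighbours x) ∎
    where
    open ≤-Reasoning
    x = vertexAt v
    E I D : Fin n → ℕ
    E u = indicator (is-just (colouring v u))
    I u = indicator (does (v ≟ u))
    D u = indicator (is-nothing (edgeColour x (vertexAt u)))
    edge-or-equal-or-disjoint : ∀ (equal : Bool) (firstAgreement : Maybe (Fin r)) →
      1 ≤ indicator (is-just (if equal then nothing else firstAgreement)) + (indicator equal + indicator (is-nothing firstAgreement))
    edge-or-equal-or-disjoint true _ = s≤s z≤n
    edge-or-equal-or-disjoint false (just _) = s≤s z≤n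
    edge-or-equal-or-disjoint false nothing = s≤s z≤n

  sum-indicator-∈ : ∀ {l} (β : Vec (Fin r) l) → sum (map (λ i → indicator (does (i ∈? β))) (allFin r)) ≤ l
  sum-indicator-∈ Vec.[] = ≤-reflexive (sum-map-zero (allFin r))
  sum-indicator-∈ {suc l} (j Vec.∷ β) = begin
    sum (map (λ i → indicator (does (i ≟ j) ∨ does (i ∈? β))) (allFin r))
      ≤⟨ sum-map-mono (λ i → indicator-∨ (does (i ≟ j)) (does (i ∈? β))) (allFin r) ⟩
    sum (map (λ i → indicator (does (i ≟ j)) + indicator (does (i ∈? β))) (allFin r))
      ≡⟨ sum-map-+ _ _ (allFin r) ⟩
    sum (map (λ i → indicator (does (i ≟ j))) (allFin r)) + sum (map (λ i → indicator (does (i ∈? β))) (allFin r))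
      ≡⟨ cong (_+ _) (trans (sum-map-cong (λ i → cong indicator (does-≟-sym i j)) (allFin r)) (sum-indicator-≟ j)) ⟩
    1 + sum (map (λ i → indicator (does (i ∈? β))) (allFin r))
      ≤⟨ s≤s (sum-indicator-∈ β) ⟩
    suc l ∎
    where open ≤-Reasoning

  minShared : ℕ
  minShared = r ∸ (b + b)

  many-shared : ∀ x β → minShared ≤ sum (map (indicator ∘ shared x β) (allFin r))
  many-shared x β = m≤n+o⇒m∸n≤o r (b + b) (begin
    r                                                  ≡⟨ sum-ones-allFin r ⟨
    sum (map (λ _ → 1) (allFin r))
      ≤⟨ sum-map-mono (λ i → one-of (does (i ∈? blocked x)) (does (i ∈? β))) (allFin r) ⟩
    sum (map (λ i → S i + (Bₓ i + Bᵦ i)) (allFin r))   ≡⟨ sum-map-+ S (λ i → Bₓ i + Bᵦ i) (allFin r) ⟩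
    sum (map S (allFin r)) + sum (map (λ i → Bₓ i + Bᵦ i) (allFin r))
      ≡⟨ cong (sum (map S (allFin r)) +_) (sum-map-+ Bₓ Bᵦ (allFin r)) ⟩
    sum (map S (allFin r)) + (sum (map Bₓ (allFin r)) + sum (map Bᵦ (allFin r)))
      ≤⟨ +-monoʳ-≤ (sum (map S (allFin r))) (+-mono-≤ (sum-indicator-∈ (blocked x)) (sum-indicator-∈ β)) ⟩
    sum (map S (allFin r)) + (b + b)                   ≡⟨ +-comm _ (b + b) ⟩
    b + b + sum (map S (allFin r))                     ∎)
    where
    open ≤-Reasoning
    S Bₓ Bᵦ : Fin r → ℕ
    S = indicator ∘ shared x β
    Bₓ i = indicator (does (i ∈? blocked x))
    Bᵦ i = indicator (does (i ∈? β))
    one-of : ∀ a a′ → 1 ≤ indicator (not a ∧ not a′) + (indicator a + indicator a′)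
    one-of true _ = s≤s z≤n
    one-of false true = s≤s z≤n
    one-of false false = s≤s z≤n

  label-count : ∀ (s : Bool) (l : Fin k) →
    sum (map (λ a → indicator (not (s ∧ does (l ≟ a)))) (allFin k)) ≡ (if s then k ∸ 1 else k)
  label-count false l = sum-ones-allFin k
  label-count true l = begin-equality
    S                                  ≡⟨ m+n∸m≡n 1 S ⟨
    1 + S ∸ 1                          ≡⟨ cong (λ t → t + S ∸ 1) (sum-indicator-≟ l) ⟨
    sum (map I (allFin k)) + S ∸ 1     ≡⟨ cong (_∸ 1) (sum-map-+ I (indicator ∘ not ∘ same) (allFin k)) ⟨
    sum (map (λ a → I a + indicator (not (same a))) (allFin k)) ∸ 1
      ≡⟨ cong (_∸ 1) (trans (sum-map-cong (λ a → indicator-+-not (same a)) (allFin k)) (sum-ones-allFin k)) ⟩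
    k ∸ 1                              ∎
    where
    open ≤-Reasoning
    same : Fin k → Bool
    same a = does (l ≟ a)
    I : Fin k → ℕ
    I = indicator ∘ same
    S = sum (map (indicator ∘ not ∘ same) (allFin k))

  choices : Vertex → Vec (Fin r) b → ℕ
  choices x β = product (map (λ i → if shared x β i then k ∸ 1 else k) (allFin r))

  -- y is not adjacent to x iff at every colour i shared by x and y the labels differ; for fixed
  -- blocked colours of y these conditions are independent across i.
  nonNeighbours≡ : ∀ x → nonNeighbours x ≡ sum (map (λ β → c * choices x β) (vectors (allFin r) b))
  nonNeighbours≡ x = begin-equality
    nonNeighbours x
      ≡⟨ sum-map-cartesianProductWith _ D βs _ ⟩
    sum (map (λ β → sum (map (λ zw → D (vertex β (proj₁ zw) (proj₂ zw))) (cartesianProduct zs (allFin c)))) βs)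
      ≡⟨ sum-map-cong (λ β → sum-map-cartesianProductWith _,_ _ zs (allFin c)) βs ⟩
    sum (map (λ β → sum (map (λ z → sum (map (λ w → D (vertex β z w)) (allFin c))) zs)) βs)
      ≡⟨ sum-map-cong (λ β → sum-map-cong (λ z → trans (sum-map-cong (disjoint-product β z) (allFin c))
                                                        (sum-map-const _ (allFin c))) zs) βs ⟩
    sum (map (λ β → sum (map (λ z → length (allFin c) * Π β z) zs)) βs)
      ≡⟨ sum-map-cong (λ β → trans (sum-map-*ˡ (length (allFin c)) (Π β) zs)
                                   (cong₂ _*_ (length-allFin c) (sum-vectors-product (avoid β) (allFin k)))) βs ⟩
    sum (map (λ β → c * product (map (λ i → sum (map (avoid β i) (allFin k))) (allFin r))) βs)
      ≡⟨ sum-map-cong (λ β → cong (λ t → c * product t)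
                                  (map-cong (λ i → label-count (shared x β i) (lookup (label x) i)) (allFin r))) βs ⟩
    sum (map (λ β → c * choices x β) βs) ∎
    where
    open ≤-Reasoning
    βs = vectors (allFin r) b
    zs = vectors (allFin k) r
    D : Vertex → ℕ
    D y = indicator (is-nothing (edgeColour x y))
    avoid : Vec (Fin r) b → Fin r → Fin k → ℕ
    avoid β i a = indicator (not (shared x β i ∧ does (lookup (label x) i ≟ a)))
    Π : Vec (Fin r) b → Vec (Fin k) r → ℕ
    Π β z = product (map (λ i → avoid β i (lookup z i)) (allFin r))
    disjoint-product : ∀ β z w → D (vertex β z w) ≡ Π β z
    disjoint-product β z w = indicator-findᵇ-nothing (agree x (vertex β z w)) (allFin r)

  nonNeighbours-bound : ∀ x → nonNeighbours x * k ^ minShared ≤ r ^ b * (c * ((k ∸ 1) ^ minShared * k ^ r))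
  nonNeighbours-bound x = begin
    nonNeighbours x * k ^ minShared
      ≡⟨ cong (_* k ^ minShared) (nonNeighbours≡ x) ⟩
    sum (map (λ β → c * choices x β) βs) * k ^ minShared
      ≡⟨ sum-map-*ʳ (k ^ minShared) (λ β → c * choices x β) βs ⟨
    sum (map (λ β → c * choices x β * k ^ minShared) βs)
      ≤⟨ sum-map-mono (λ β → ≤-trans (≤-reflexive (*-assoc c (choices x β) (k ^ minShared))) (*-monoʳ-≤ c (bound β))) βs ⟩
    sum (map (λ _ → c * ((k ∸ 1) ^ minShared * k ^ r)) βs)
      ≡⟨ sum-map-const _ βs ⟩
    length βs * (c * ((k ∸ 1) ^ minShared * k ^ r))
      ≡⟨ cong (_* (c * ((k ∸ 1) ^ minShared * k ^ r))) (trans (length-vectors (allFin r) b) (cong (_^ b) (length-allFin r))) ⟩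
    r ^ b * (c * ((k ∸ 1) ^ minShared * k ^ r)) ∎
    where
    open ≤-Reasoning
    βs = vectors (allFin r) b
    bound : ∀ β → choices x β * k ^ minShared ≤ (k ∸ 1) ^ minShared * k ^ r
    bound β = ≤-trans (product-choices-bound k minShared (shared x β) (allFin r) (many-shared x β))
                      (≤-reflexive (cong (λ l → (k ∸ 1) ^ minShared * k ^ l) (length-allFin r)))

  agree⇒ : ∀ x y {i} → agree x y i ≡ true → active x i ≡ true × lookup (label x) i ≡ lookup (label y) i
  agree⇒ x y {i} eq with active x i | active y i | lookup (label x) i ≟ lookup (label y) i
  ... | true | true | yes same = refl , same

  colouring⇒agree : ∀ u v {i} → colouring u v ≡ just i → agree (vertexAt u) (vertexAt v) i ≡ true
  colouring⇒agree u v eq = findᵇ-just (agree (vertexAt u) (vertexAt v)) (allFin r) (unless-equal (does (u ≟ v)) _ eq)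
    where
    unless-equal : ∀ (e : Bool) (m : Maybe (Fin r)) {i} → (if e then nothing else m) ≡ just i → m ≡ just i
    unless-equal false m eq = eq

  module _ (T : MonoTree G) where

    treeVertex : Fin (suc (m T)) → Vertex
    treeVertex j = vertexAt (w T j)

    treeClass : Fin k
    treeClass = lookup (label (treeVertex zero)) (colour T)

    tree-edge-agrees : ∀ j → agree (treeVertex (suc j)) (treeVertex (par T j)) (colour T) ≡ true
    tree-edge-agrees j = colouring⇒agree (w T (suc j)) (w T (par T j)) (edge T j)

    -- By induction on toℕ j, since every parent precedes its child.
    label-along-tree : ∀ fuel j → toℕ j ≤ fuel → lookup (label (treeVertex j)) (colour T) ≡ treeClass
    label-along-tree _ zero _ = refl
    label-along-tree (suc fuel) (suc j) (s≤s j≤fuel) =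
      trans (proj₂ (agree⇒ (treeVertex (suc j)) (treeVertex (par T j)) (tree-edge-agrees j)))
            (label-along-tree fuel (par T j) (≤-trans (par≤ T j) j≤fuel))

    active-off-root : ∀ j → active (treeVertex (suc j)) (colour T) ≡ true
    active-off-root j = proj₁ (agree⇒ (treeVertex (suc j)) (treeVertex (par T j)) (tree-edge-agrees j))

  module Cover {{_ : NonZero r}} {{_ : NonZero k}} (ts : List (MonoTree G))
               (few : length ts < k * suc b) (tags-fit : k * suc b ≤ c) where

    treesOfColour : Fin r → List (MonoTree G)
    treesOfColour i = filter (λ T → colour T ≟ i) ts

    load : Fin r → ℕ
    load i = length (treesOfColour i)

    heavyColours : List (Fin r)
    heavyColours = filter (λ i → k ≤? load i) (allFin r)

    few-heavy : length heavyColours ≤ b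
    few-heavy = ≤-pred (*-cancelʳ-< _ (length heavyColours) (suc b) (begin-strict
      length heavyColours * k     ≤⟨ length-filter-*≤sum (λ i → k ≤? load i) load k (λ _ heavy → heavy) (allFin r) ⟩
      sum (map load (allFin r))   ≡⟨ sum-length-fibres colour ts ⟩
      length ts                   <⟨ few ⟩
      k * suc b                   ≡⟨ *-comm k (suc b) ⟩
      suc b * k                   ∎))
      where open ≤-Reasoning

    -- Padding blocks some further colour, which does no harm.
    β₀ : Vec (Fin r) b
    β₀ = padRight few-heavy (fromℕ< (>-nonZero⁻¹ r)) (Vec.fromList heavyColours)

    heavy⇒blocked : ∀ i → k ≤ load i → i VecMembership.∈ β₀
    heavy⇒blocked i heavy = ∈-padRight few-heavy _ (∈-fromList⁺ (∈-filter⁺ (λ i → k ≤? load i) (∈-allFin i) heavy))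

    classesOfColour : Fin r → List (Fin k)
    classesOfColour i = map treeClass (treesOfColour i)

    few-classes : ∀ i → ¬ (k ≤ load i) → length (classesOfColour i) < k
    few-classes i light = subst (_< k) (sym (length-map treeClass (treesOfColour i))) (≰⇒> light)

    unusedClass : ∀ i → Dec (k ≤ load i) → Fin k
    unusedClass i (yes _) = fromℕ< (>-nonZero⁻¹ k)
    unusedClass i (no light) = proj₁ (∃∉-short-list (classesOfColour i) (few-classes i light))

    unusedClass-∉ : ∀ i → ¬ (k ≤ load i) → unusedClass i (k ≤? load i) ∉ classesOfColour i
    unusedClass-∉ i light with k ≤? load i
    ... | yes heavy = ⊥-elim (light heavy)
    ... | no light′ = proj₂ (∃∉-short-list (classesOfColour i) (few-classes i light′))

    rootTags : List (Fin c)
    rootTags = map (λ T → tag (treeVertex T zero)) ts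

    unusedTag : ∃ λ w₀ → w₀ ∉ rootTags
    unusedTag = ∃∉-short-list rootTags (subst (_< c) (sym (length-map _ ts)) (<-≤-trans few tags-fit))

    x₀ : Vertex
    x₀ = vertex β₀ (Vec.tabulate (λ i → unusedClass i (k ≤? load i))) (proj₁ unusedTag)

    u₀ : Fin n
    u₀ = Any.index (∈-vertices x₀)

    u₀↦x₀ : vertexAt u₀ ≡ x₀
    u₀↦x₀ = sym (lookup-index (∈-vertices x₀))

    not-in-tree : ∀ T → T ∈ ts → ¬ (u₀ ∈T T)
    not-in-tree T T∈ts (zero , root≡u₀) = proj₂ unusedTag (subst (_∈ rootTags) tag≡ (∈-map⁺ _ T∈ts))
      where
      tag≡ : tag (treeVertex T zero) ≡ proj₁ unusedTag
      tag≡ = cong tag (trans (cong vertexAt root≡u₀) u₀↦x₀)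
    not-in-tree T T∈ts (suc j , wj≡u₀) =
      unusedClass-∉ i light
        (subst (_∈ classesOfColour i) class≡ (∈-map⁺ treeClass (∈-filter⁺ (λ T → colour T ≟ i) T∈ts refl)))
      where
      i = colour T
      at-x₀ : treeVertex T (suc j) ≡ x₀
      at-x₀ = trans (cong vertexAt wj≡u₀) u₀↦x₀
      x₀-active : active x₀ i ≡ true
      x₀-active = subst (λ y → active y i ≡ true) at-x₀ (active-off-root T j)
      unblocked : ¬ (i VecMembership.∈ β₀)
      unblocked i∈β₀ with trans (sym x₀-active) (cong not (dec-true (i ∈? β₀) i∈β₀))
      ... | ()
      light : ¬ (k ≤ load i)
      light heavy = unblocked (heavy⇒blocked i heavy)
      class≡ : treeClass T ≡ unusedClass i (k ≤? load i)
      class≡ = trans (sym (label-along-tree T (toℕ (suc j)) (suc j) ≤-refl))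
                     (trans (cong (λ y → lookup (label y) i) at-x₀) (lookup∘tabulate _ i))

    uncovered : ¬ Any (u₀ ∈T_) ts
    uncovered cov with T , T∈ts , u₀∈T ← find cov = not-in-tree T T∈ts u₀∈T

  cover-bound : {{_ : NonZero r}} {{_ : NonZero k}} → k * suc b ≤ c →
    ∀ (ts : List (MonoTree G)) → Covers ts → k * suc b ≤ length ts
  cover-bound tags-fit ts cov with k * suc b ≤? length ts
  ... | yes enough = enough
  ... | no few = ⊥-elim (Cover.uncovered ts (≰⇒> few) tags-fit (cov (Cover.u₀ ts (≰⇒> few) tags-fit)))

-- Rational arithmetic

ℕtoℚ-toℚᵘ : ∀ a → ℚ.toℚᵘ (ℕtoℚ a) ℚᵘ.≃ mkℚᵘ (ℤ.+ a) 0
ℕtoℚ-toℚᵘ a = ℚ.toℚᵘ-fromℚᵘ (mkℚᵘ (ℤ.+ a) 0)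

ℕtoℚ-+ : ∀ a b → ℕtoℚ (a + b) ≡ ℕtoℚ a ℚ.+ ℕtoℚ b
ℕtoℚ-+ a b = ℚ.toℚᵘ-injective (begin
  ℚ.toℚᵘ (ℕtoℚ (a + b))                    ≈⟨ ℕtoℚ-toℚᵘ (a + b) ⟩
  mkℚᵘ (ℤ.+ (a + b)) 0                     ≈⟨ *≡* (cong (ℤ._* 1ℤ) (trans (ℤ.pos-+ a b)
                                                (sym (cong₂ ℤ._+_ (ℤ.*-identityʳ (ℤ.+ a)) (ℤ.*-identityʳ (ℤ.+ b)))))) ⟩
  mkℚᵘ (ℤ.+ a) 0 ℚᵘ.+ mkℚᵘ (ℤ.+ b) 0       ≈⟨ ℚᵘ.+-cong (ℕtoℚ-toℚᵘ a) (ℕtoℚ-toℚᵘ b) ⟨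
  ℚ.toℚᵘ (ℕtoℚ a) ℚᵘ.+ ℚ.toℚᵘ (ℕtoℚ b)     ≈⟨ ℚ.toℚᵘ-homo-+ (ℕtoℚ a) (ℕtoℚ b) ⟨
  ℚ.toℚᵘ (ℕtoℚ a ℚ.+ ℕtoℚ b)               ∎)
  where open ℚᵘ.≃-Reasoning

ℕtoℚ-* : ∀ a b → ℕtoℚ (a * b) ≡ ℕtoℚ a ℚ.* ℕtoℚ b
ℕtoℚ-* a b = ℚ.toℚᵘ-injective (begin
  ℚ.toℚᵘ (ℕtoℚ (a * b))                    ≈⟨ ℕtoℚ-toℚᵘ (a * b) ⟩
  mkℚᵘ (ℤ.+ (a * b)) 0                     ≈⟨ *≡* (cong (ℤ._* 1ℤ) (ℤ.pos-* a b)) ⟩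
  mkℚᵘ (ℤ.+ a) 0 ℚᵘ.* mkℚᵘ (ℤ.+ b) 0       ≈⟨ ℚᵘ.*-cong (ℕtoℚ-toℚᵘ a) (ℕtoℚ-toℚᵘ b) ⟨
  ℚ.toℚᵘ (ℕtoℚ a) ℚᵘ.* ℚ.toℚᵘ (ℕtoℚ b)     ≈⟨ ℚ.toℚᵘ-homo-* (ℕtoℚ a) (ℕtoℚ b) ⟨
  ℚ.toℚᵘ (ℕtoℚ a ℚ.* ℕtoℚ b)               ∎)
  where open ℚᵘ.≃-Reasoning

ℕtoℚ-double : ∀ a → ℕtoℚ (2 * a) ≡ ℕtoℚ a ℚ.+ ℕtoℚ a
ℕtoℚ-double a = trans (cong (λ b → ℕtoℚ (a + b)) (+-identityʳ a)) (ℕtoℚ-+ a a)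

ℕtoℚ-mono-≤ : ∀ {a b} → a ≤ b → ℕtoℚ a ℚ.≤ ℕtoℚ b
ℕtoℚ-mono-≤ {a} {b} a≤b = ℚ.toℚᵘ-cancel-≤ (begin
  ℚ.toℚᵘ (ℕtoℚ a)   ≃⟨ ℕtoℚ-toℚᵘ a ⟩
  mkℚᵘ (ℤ.+ a) 0    ≤⟨ *≤* (ℤ.*-monoʳ-≤-nonNeg 1ℤ (ℤ.+≤+ a≤b)) ⟩
  mkℚᵘ (ℤ.+ b) 0    ≃⟨ ℕtoℚ-toℚᵘ b ⟨
  ℚ.toℚᵘ (ℕtoℚ b)   ∎)
  where open ℚᵘ.≤-Reasoning

ℕtoℚ-mono-< : ∀ {a b} → a < b → ℕtoℚ a ℚ.< ℕtoℚ b
ℕtoℚ-mono-< {a} {b} a<b = ℚ.toℚᵘ-cancel-< (begin-strict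
  ℚ.toℚᵘ (ℕtoℚ a)   ≃⟨ ℕtoℚ-toℚᵘ a ⟩
  mkℚᵘ (ℤ.+ a) 0    <⟨ *<* (ℤ.*-monoʳ-<-pos 1ℤ (ℤ.+<+ a<b)) ⟩
  mkℚᵘ (ℤ.+ b) 0    ≃⟨ ℕtoℚ-toℚᵘ b ⟨
  ℚ.toℚᵘ (ℕtoℚ b)   ∎)
  where open ℚᵘ.≤-Reasoning

ℕtoℚ-positive : ∀ {a} → 0 < a → ℚ.Positive (ℕtoℚ a)
ℕtoℚ-positive 0<a = ℚ.positive (ℕtoℚ-mono-< 0<a)

/-*-cancel : ∀ a d .{{_ : NonZero d}} → ((ℤ.+ a) ℚ./ d) ℚ.* ℕtoℚ d ≡ ℕtoℚ a
/-*-cancel a (suc d) = ℚ.toℚᵘ-injective (begin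
  ℚ.toℚᵘ ((ℤ.+ a) ℚ./ suc d ℚ.* ℕtoℚ (suc d))
    ≈⟨ ℚ.toℚᵘ-homo-* ((ℤ.+ a) ℚ./ suc d) (ℕtoℚ (suc d)) ⟩
  ℚ.toℚᵘ ((ℤ.+ a) ℚ./ suc d) ℚᵘ.* ℚ.toℚᵘ (ℕtoℚ (suc d))
    ≈⟨ ℚᵘ.*-cong (ℚ.toℚᵘ-fromℚᵘ (mkℚᵘ (ℤ.+ a) d)) (ℕtoℚ-toℚᵘ (suc d)) ⟩
  mkℚᵘ (ℤ.+ a) d ℚᵘ.* mkℚᵘ (ℤ.+ suc d) 0
    ≈⟨ *≡* (trans (ℤ.*-assoc (ℤ.+ a) (ℤ.+ suc d) 1ℤ) (sym (cong (ℤ.+ a ℤ.*_) (ℤ.pos-* (suc d) 1)))) ⟩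
  mkℚᵘ (ℤ.+ a) 0
    ≈⟨ ℕtoℚ-toℚᵘ a ⟨
  ℚ.toℚᵘ (ℕtoℚ a) ∎)
  where open ℚᵘ.≃-Reasoning

as-fraction : ∀ δ → 0ℚ ℚ.< δ → δ ℚ.< 1ℚ → ∃₂ λ p q → δ ℚ.* ℕtoℚ q ≡ ℕtoℚ p × 1 ≤ p × p < q
as-fraction δ@(mkℚ (ℤ.+ p) q-1 _) 0<δ δ<1 = p , suc q-1 , δq≡p , 1≤p , p<q
  where
  δq≡p : δ ℚ.* ℕtoℚ (suc q-1) ≡ ℕtoℚ p
  δq≡p = trans (cong (ℚ._* ℕtoℚ (suc q-1)) (sym (ℚ.↥p/↧p≡p δ))) (/-*-cancel p (suc q-1))
  1≤p : 1 ≤ p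
  1≤p = ℤ.drop‿+<+ (subst₂ ℤ._<_ (ℤ.*-zeroˡ (ℤ.+ suc q-1)) (ℤ.*-identityʳ (ℤ.+ p)) (ℚ.drop-*<* 0<δ))
  p<q : p < suc q-1
  p<q = ℤ.drop‿+<+ (subst₂ ℤ._<_ (ℤ.*-identityʳ (ℤ.+ p)) (ℤ.*-identityˡ (ℤ.+ suc q-1)) (ℚ.drop-*<* δ<1))
as-fraction (mkℚ -[1+ _ ] _ _) 0<δ _ with () ← ℚ.drop-*<* 0<δ

module _ {δ : ℚ} {p q : ℕ} (δq≡p : δ ℚ.* ℕtoℚ q ≡ ℕtoℚ p) .{{_ : NonZero q}} where
  open +-*-Solver

  [1-δ]*n≤d : ∀ {n d e} → n ≤ d + e → q * e ≤ p * n → (1ℚ ℚ.- δ) ℚ.* ℕtoℚ n ℚ.≤ ℕtoℚ d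
  [1-δ]*n≤d {n} {d} {e} n≤d+e qe≤pn = begin
    (1ℚ ℚ.- δ) ℚ.* N              ≡⟨ solve 2 (λ x y → (con 1ℚ :- x) :* y := y :- x :* y) refl δ N ⟩
    N ℚ.- δ ℚ.* N                 ≤⟨ ℚ.+-monoˡ-≤ (ℚ.- (δ ℚ.* N)) N≤D+δN ⟩
    (D ℚ.+ δ ℚ.* N) ℚ.- δ ℚ.* N   ≡⟨ solve 2 (λ x y → (x :+ y) :- y := x) refl D (δ ℚ.* N) ⟩
    D                             ∎
    where
    open ℚ.≤-Reasoning
    N = ℕtoℚ n
    D = ℕtoℚ d
    E≤δN : ℕtoℚ e ℚ.≤ δ ℚ.* N
    E≤δN = ℚ.*-cancelˡ-≤-pos (ℕtoℚ q) {{ℕtoℚ-positive (>-nonZero⁻¹ q)}} (begin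
      ℕtoℚ q ℚ.* ℕtoℚ e         ≡⟨ ℕtoℚ-* q e ⟨
      ℕtoℚ (q * e)              ≤⟨ ℕtoℚ-mono-≤ qe≤pn ⟩
      ℕtoℚ (p * n)              ≡⟨ ℕtoℚ-* p n ⟩
      ℕtoℚ p ℚ.* N              ≡⟨ cong (ℚ._* N) δq≡p ⟨
      δ ℚ.* ℕtoℚ q ℚ.* N        ≡⟨ solve 3 (λ x y z → (x :* y) :* z := y :* (x :* z)) refl δ (ℕtoℚ q) N ⟩
      ℕtoℚ q ℚ.* (δ ℚ.* N)      ∎)
    N≤D+δN : N ℚ.≤ D ℚ.+ δ ℚ.* N
    N≤D+δN = ℚ.≤-trans (ℕtoℚ-mono-≤ n≤d+e) (ℚ.≤-trans (ℚ.≤-reflexive (ℕtoℚ-+ d e)) (ℚ.+-monoʳ-≤ D E≤δN))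

  ^ℚ-as-fraction : ∀ j → (δ ^ℚ j) ℚ.* ℕtoℚ (q ^ j) ≡ ℕtoℚ (p ^ j)
  ^ℚ-as-fraction zero = refl
  ^ℚ-as-fraction (suc j) = begin-equality
    δ ℚ.* (δ ^ℚ j) ℚ.* ℕtoℚ (q * q ^ j)                   ≡⟨ cong (δ ℚ.* (δ ^ℚ j) ℚ.*_) (ℕtoℚ-* q (q ^ j)) ⟩
    δ ℚ.* (δ ^ℚ j) ℚ.* (ℕtoℚ q ℚ.* ℕtoℚ (q ^ j))
      ≡⟨ solve 4 (λ a b c d → (a :* b) :* (c :* d) := (a :* c) :* (b :* d)) refl δ (δ ^ℚ j) (ℕtoℚ q) (ℕtoℚ (q ^ j)) ⟩
    (δ ℚ.* ℕtoℚ q) ℚ.* ((δ ^ℚ j) ℚ.* ℕtoℚ (q ^ j))        ≡⟨ cong₂ ℚ._*_ δq≡p (^ℚ-as-fraction j) ⟩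
    ℕtoℚ p ℚ.* ℕtoℚ (p ^ j)                               ≡⟨ ℕtoℚ-* p (p ^ j) ⟨
    ℕtoℚ (p * p ^ j)                                      ∎
    where open ℚ.≤-Reasoning

  ^ℚ*ℕtoℚ≤1 : ∀ j B → p ^ j * B ≤ q ^ j → (δ ^ℚ j) ℚ.* ℕtoℚ B ℚ.≤ 1ℚ
  ^ℚ*ℕtoℚ≤1 j B pʲB≤qʲ = ℚ.*-cancelˡ-≤-pos Qʲ {{ℕtoℚ-positive (m^n>0 q j)}} (begin
    Qʲ ℚ.* ((δ ^ℚ j) ℚ.* ℕtoℚ B)      ≡⟨ solve 3 (λ a b c → a :* (b :* c) := (b :* a) :* c) refl
                                             Qʲ (δ ^ℚ j) (ℕtoℚ B) ⟩
    ((δ ^ℚ j) ℚ.* Qʲ) ℚ.* ℕtoℚ B      ≡⟨ cong (ℚ._* ℕtoℚ B) (^ℚ-as-fraction j) ⟩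
    ℕtoℚ (p ^ j) ℚ.* ℕtoℚ B           ≡⟨ ℕtoℚ-* (p ^ j) B ⟨
    ℕtoℚ (p ^ j * B)                  ≤⟨ ℕtoℚ-mono-≤ pʲB≤qʲ ⟩
    Qʲ                                ≡⟨ ℚ.*-identityʳ Qʲ ⟨
    Qʲ ℚ.* 1ℚ                         ∎)
    where
    open ℚ.≤-Reasoning
    Qʲ = ℕtoℚ (q ^ j)

^ℚ-nonNegative : ∀ {δ} → 0ℚ ℚ.≤ δ → ∀ j → 0ℚ ℚ.≤ δ ^ℚ j
^ℚ-nonNegative 0≤δ zero = ℕtoℚ-mono-≤ {0} {1} z≤n
^ℚ-nonNegative {δ} 0≤δ (suc j) = ℚ.nonNegative⁻¹ (δ ℚ.* (δ ^ℚ j))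
  {{ℚ.nonNeg*nonNeg⇒nonNeg δ {{ℚ.nonNegative 0≤δ}} (δ ^ℚ j) {{ℚ.nonNegative (^ℚ-nonNegative 0≤δ j)}}}}

*-≤-one : ∀ {S B d : ℚ} → S ℚ.≤ B → 0ℚ ℚ.≤ d → d ℚ.* B ℚ.≤ 1ℚ → S ℚ.* d ℚ.≤ 1ℚ
*-≤-one {S} {B} {d} S≤B 0≤d dB≤1 = begin
  S ℚ.* d    ≤⟨ ℚ.*-monoʳ-≤-nonNeg d {{ℚ.nonNegative 0≤d}} S≤B ⟩
  B ℚ.* d    ≡⟨ ℚ.*-comm B d ⟩
  d ℚ.* B    ≤⟨ dB≤1 ⟩
  1ℚ         ∎
  where open ℚ.≤-Reasoning

expTerm-bound : ∀ r M → ℕtoℚ (2 ^ M) ℚ.* ((ℤ.+ (r ^ M) ℚ./ (M !)) {{M !≢0}}) ℚ.≤ ℕtoℚ (2 ^ (4 * r))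
expTerm-bound r M = ℚ.*-cancelʳ-≤-pos (ℕtoℚ (M !)) {{ℕtoℚ-positive (1≤n! M)}} (begin
  (ℕtoℚ (2 ^ M) ℚ.* term) ℚ.* ℕtoℚ (M !)   ≡⟨ ℚ.*-assoc (ℕtoℚ (2 ^ M)) term (ℕtoℚ (M !)) ⟩
  ℕtoℚ (2 ^ M) ℚ.* (term ℚ.* ℕtoℚ (M !))   ≡⟨ cong (ℕtoℚ (2 ^ M) ℚ.*_) (/-*-cancel (r ^ M) (M !) {{M !≢0}}) ⟩
  ℕtoℚ (2 ^ M) ℚ.* ℕtoℚ (r ^ M)            ≡⟨ ℕtoℚ-* (2 ^ M) (r ^ M) ⟨
  ℕtoℚ (2 ^ M * r ^ M)                     ≤⟨ ℕtoℚ-mono-≤ (2^*^≤2^[4*]*! r M) ⟩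
  ℕtoℚ (2 ^ (4 * r) * M !)                 ≡⟨ ℕtoℚ-* (2 ^ (4 * r)) (M !) ⟩
  ℕtoℚ (2 ^ (4 * r)) ℚ.* ℕtoℚ (M !)        ∎)
  where
  open ℚ.≤-Reasoning
  term = (ℤ.+ (r ^ M) ℚ./ (M !)) {{M !≢0}}

-- Each term rⁱ/i! is at most T/2ⁱ with T = 2^(4r), so 2ᴹ times the partial sum stays below 2T(2ᴹ − 1).
expPartial-scaled : ∀ r M → let 2ᴹ = ℕtoℚ (2 ^ M); T = ℕtoℚ (2 ^ (4 * r)) in
  2ᴹ ℚ.* expPartial r M ℚ.+ (T ℚ.+ T) ℚ.≤ 2ᴹ ℚ.* (T ℚ.+ T)
expPartial-scaled r zero =
  ℚ.≤-reflexive (solve 1 (λ x → con 1ℚ :* con 0ℚ :+ (x :+ x) := con 1ℚ :* (x :+ x)) refl (ℕtoℚ (2 ^ (4 * r))))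
  where open +-*-Solver
expPartial-scaled r (suc M) = begin
  ℕtoℚ (2 * 2 ^ M) ℚ.* (S ℚ.+ t) ℚ.+ (T ℚ.+ T)
    ≡⟨ cong (λ u → u ℚ.* (S ℚ.+ t) ℚ.+ (T ℚ.+ T)) (ℕtoℚ-double (2 ^ M)) ⟩
  (2ᴹ ℚ.+ 2ᴹ) ℚ.* (S ℚ.+ t) ℚ.+ (T ℚ.+ T)
    ≡⟨ solve 4 (λ a s t′ T′ → (a :+ a) :* (s :+ t′) :+ (T′ :+ T′) := (a :* s :+ (T′ :+ T′)) :+ (a :* s :+ (a :* t′ :+ a :* t′)))
               refl 2ᴹ S t T ⟩
  (2ᴹ ℚ.* S ℚ.+ (T ℚ.+ T)) ℚ.+ (2ᴹ ℚ.* S ℚ.+ (2ᴹ ℚ.* t ℚ.+ 2ᴹ ℚ.* t))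
    ≤⟨ ℚ.+-mono-≤ (expPartial-scaled r M) (ℚ.+-monoʳ-≤ (2ᴹ ℚ.* S) (ℚ.+-mono-≤ (expTerm-bound r M) (expTerm-bound r M))) ⟩
  2ᴹ ℚ.* (T ℚ.+ T) ℚ.+ (2ᴹ ℚ.* S ℚ.+ (T ℚ.+ T))
    ≤⟨ ℚ.+-monoʳ-≤ (2ᴹ ℚ.* (T ℚ.+ T)) (expPartial-scaled r M) ⟩
  2ᴹ ℚ.* (T ℚ.+ T) ℚ.+ 2ᴹ ℚ.* (T ℚ.+ T)
    ≡⟨ solve 2 (λ a x → a :* x :+ a :* x := (a :+ a) :* x) refl 2ᴹ (T ℚ.+ T) ⟩
  (2ᴹ ℚ.+ 2ᴹ) ℚ.* (T ℚ.+ T)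
    ≡⟨ cong (ℚ._* (T ℚ.+ T)) (ℕtoℚ-double (2 ^ M)) ⟨
  ℕtoℚ (2 * 2 ^ M) ℚ.* (T ℚ.+ T) ∎
  where
  open ℚ.≤-Reasoning
  open +-*-Solver
  2ᴹ = ℕtoℚ (2 ^ M)
  S = expPartial r M
  t = (ℤ.+ (r ^ M) ℚ./ (M !)) {{M !≢0}}
  T = ℕtoℚ (2 ^ (4 * r))

expPartial-bound : ∀ r M → expPartial r M ℚ.≤ ℕtoℚ (2 * 2 ^ (4 * r))
expPartial-bound r M = ℚ.*-cancelˡ-≤-pos 2ᴹ {{ℕtoℚ-positive (m^n>0 2 M)}} (begin
  2ᴹ ℚ.* expPartial r M                    ≡⟨ ℚ.+-identityʳ _ ⟨
  2ᴹ ℚ.* expPartial r M ℚ.+ 0ℚ             ≤⟨ ℚ.+-monoʳ-≤ (2ᴹ ℚ.* expPartial r M) 0≤T+T ⟩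
  2ᴹ ℚ.* expPartial r M ℚ.+ (T ℚ.+ T)      ≤⟨ expPartial-scaled r M ⟩
  2ᴹ ℚ.* (T ℚ.+ T)                         ≡⟨ cong (2ᴹ ℚ.*_) (ℕtoℚ-double (2 ^ (4 * r))) ⟨
  2ᴹ ℚ.* ℕtoℚ (2 * 2 ^ (4 * r))            ∎)
  where
  open ℚ.≤-Reasoning
  2ᴹ = ℕtoℚ (2 ^ M)
  T = ℕtoℚ (2 ^ (4 * r))
  0≤T+T : 0ℚ ℚ.≤ T ℚ.+ T
  0≤T+T = ℚ.≤-trans (ℕtoℚ-mono-≤ {0} {2 * 2 ^ (4 * r)} z≤n) (ℚ.≤-reflexive (ℕtoℚ-double (2 ^ (4 * r))))

-- Choice of parameters

r<[1+r/4]*4 : ∀ r → r < suc (r / 4) * 4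
r<[1+r/4]*4 r = begin-strict
  r                  ≡⟨ m≡m%n+[m/n]*n r 4 ⟩
  r % 4 + r / 4 * 4  <⟨ +-monoˡ-< (r / 4 * 4) (m%n<n r 4) ⟩
  4 + r / 4 * 4      ∎
  where open ≤-Reasoning

[b+b]≤r : ∀ {b r} → b * 4 ≤ r → b + b ≤ r
[b+b]≤r {b} b*4≤r = ≤-trans (≤-trans (m≤m+n (b + b) (b + b)) (≤-reflexive (double-double b))) b*4≤r
  where
  double-double : ∀ b → b + b + (b + b) ≡ b * 4
  double-double = solve-∀

1+4r≤10[r∸2b] : ∀ {b r} → b * 4 ≤ r → 1 ≤ r → suc (4 * r) ≤ 10 * (r ∸ (b + b))
1+4r≤10[r∸2b] {b} {r} b*4≤r 1≤r = +-cancelʳ-≤ (20 * b) (suc (4 * r)) (10 * s) (begin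
  suc (4 * r) + 20 * b        ≡⟨ cong (suc (4 * r) +_) (twenty b) ⟩
  suc (4 * r) + 5 * (b * 4)   ≤⟨ +-monoʳ-≤ (suc (4 * r)) (*-monoʳ-≤ 5 b*4≤r) ⟩
  suc (4 * r) + 5 * r         ≤⟨ +-monoˡ-≤ (5 * r) (+-monoˡ-≤ (4 * r) 1≤r) ⟩
  r + 4 * r + 5 * r           ≡⟨ ten r ⟩
  10 * r                      ≡⟨ cong (10 *_) (m∸n+n≡m ([b+b]≤r {b} b*4≤r)) ⟨
  10 * (s + (b + b))          ≡⟨ distrib s b ⟩
  10 * s + 20 * b             ∎)
  where
  open ≤-Reasoning
  s = r ∸ (b + b)
  twenty : ∀ b → 20 * b ≡ 5 * (b * 4)
  twenty = solve-∀
  ten : ∀ r → r + 4 * r + 5 * r ≡ 10 * r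
  ten = solve-∀
  distrib : ∀ s b → 10 * (s + (b + b)) ≡ 10 * s + 20 * b
  distrib = solve-∀

-- A crossing point of k ↦ [(1 − 1/k)ˢ < p/q], which holds at k = 1 and fails once k > q·s.
threshold : ∀ {p q s} → 1 ≤ p → p < q → 1 ≤ s →
  Σ ℕ λ k → 1 ≤ k × q * (k ∸ 1) ^ s < p * k ^ s × p * suc k ^ s ≤ q * k ^ s
threshold {p} {q} {s} 1≤p p<q 1≤s =
  let k , 1≤k , below , ¬below′ = crossing (λ k → q * (k ∸ 1) ^ s <? p * k ^ s) (q * s) 1 at-1 eventually-above
  in k , 1≤k , below , ≮⇒≥ ¬below′
  where
  0^s≡0 : ∀ {s} → 1 ≤ s → 0 ^ s ≡ 0
  0^s≡0 {suc s} _ = refl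
  at-1 : q * 0 ^ s < p * 1 ^ s
  at-1 rewrite 0^s≡0 1≤s | ^-zeroˡ s | *-zeroʳ q | *-identityʳ p = 1≤p
  eventually-above : ∀ x → suc (q * s) ≤ x → ¬ (q * (x ∸ 1) ^ s < p * x ^ s)
  eventually-above (suc x) (s≤s qs≤x) = ≤⇒≯ (p*[1+x]^m≤q*x^m p<q qs≤x 1≤s)

-- The inequality q·(1 + X) ≤ p·n, multiplied by K = kˢ to avoid division.
degree-arithmetic : ∀ {q p X A K R C L} → q * A + 1 ≤ p * K → q * K ≤ R * (L * C) → X * K ≤ R * (C * (A * L)) →
  q * (1 + X) * K ≤ p * (R * (L * C)) * K
degree-arithmetic {q} {p} {X} {A} {K} {R} {C} {L} qA<pK qK≤n XK≤ = begin
  q * (1 + X) * K                        ≡⟨ expand q X K ⟩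
  q * K + q * (X * K)                    ≤⟨ +-mono-≤ qK≤n (*-monoʳ-≤ q XK≤) ⟩
  R * (L * C) + q * (R * (C * (A * L)))  ≡⟨ factor q A R C L ⟩
  (q * A + 1) * (R * (L * C))            ≤⟨ *-monoˡ-≤ (R * (L * C)) qA<pK ⟩
  p * K * (R * (L * C))                  ≡⟨ swap p K (R * (L * C)) ⟩
  p * (R * (L * C)) * K                  ∎
  where
  open ≤-Reasoning
  expand : ∀ q X K → q * (1 + X) * K ≡ q * K + q * (X * K)
  expand = solve-∀
  factor : ∀ q A R C L → R * (L * C) + q * (R * (C * (A * L))) ≡ (q * A + 1) * (R * (L * C))
  factor = solve-∀
  swap : ∀ p K n → p * K * n ≡ p * n * K
  swap = solve-∀

cover-arithmetic : ∀ {r b K k t} → r < suc b * 4 → K ≤ 10 * suc k → 1 ≤ k → k * suc b ≤ t → r * K ≤ 120 * t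
cover-arithmetic {r} {b} {K} {k} {t} r<4[b+1] K≤ 1≤k enough = begin
  r * K                        ≤⟨ *-mono-≤ (<⇒≤ r<4[b+1]) (≤-trans K≤ (*-monoʳ-≤ 10 (+-monoˡ-≤ k 1≤k))) ⟩
  suc b * 4 * (10 * (k + k))   ≡⟨ regroup b k ⟩
  80 * (k * suc b)             ≤⟨ *-monoˡ-≤ (k * suc b) (m≤m+n 80 40) ⟩
  120 * (k * suc b)            ≤⟨ *-monoʳ-≤ 120 enough ⟩
  120 * t                      ∎
  where
  open ≤-Reasoning
  regroup : ∀ b k → (1 + b) * 4 * (10 * (k + k)) ≡ 80 * (k * (1 + b))
  regroup = solve-∀

1≤r∸[b+b] : ∀ {b r} → b * 4 ≤ r → 1 ≤ r → 1 ≤ r ∸ (b + b)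
1≤r∸[b+b] {b} {r} b*4≤r 1≤r = *-cancelˡ-< 10 0 (r ∸ (b + b)) (≤-trans (s≤s z≤n) (1+4r≤10[r∸2b] {b} b*4≤r 1≤r))

module Witness (r b : ℕ) (2≤r : 2 ≤ r) (b*4≤r : b * 4 ≤ r) (r<[1+b]*4 : r < suc b * 4)
               (δ : ℚ) (0<δ : 0ℚ ℚ.< δ) (p q : ℕ) (δq≡p : δ ℚ.* ℕtoℚ q ≡ ℕtoℚ p) (p<q : p < q)
               (k : ℕ) (1≤k : 1 ≤ k) ([1-1/k]ˢ<δ : q * (k ∸ 1) ^ (r ∸ (b + b)) < p * k ^ (r ∸ (b + b)))
               (δ≤[1-1/[k+1]]ˢ : p * suc k ^ (r ∸ (b + b)) ≤ q * k ^ (r ∸ (b + b))) (N : ℕ) where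

  s : ℕ
  s = r ∸ (b + b)

  1+4r≤10s : suc (4 * r) ≤ 10 * s
  1+4r≤10s = 1+4r≤10[r∸2b] {b} b*4≤r (≤-trans (s≤s z≤n) 2≤r)

  instance
    r≢0 : NonZero r
    r≢0 = >-nonZero (≤-trans (s≤s z≤n) 2≤r)
    q≢0 : NonZero q
    q≢0 = >-nonZero (≤-trans (s≤s z≤n) p<q)
    k≢0 : NonZero k
    k≢0 = >-nonZero 1≤k

  c : ℕ
  c = q + N + k * suc b

  open Graph r b k c public using (n; G)
  open Graph r b k c using (n≡; vertexAt; nonNeighbours; n≤deg+1+nonNeighbours; nonNeighbours-bound; cover-bound)

  N≤n : N ≤ n
  N≤n = begin
    N                      ≤⟨ ≤-trans (m≤n+m N q) (m≤m+n (q + N) (k * suc b)) ⟩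
    c                      ≤⟨ m≤n*m c (r ^ b * k ^ r) {{m*n≢0 (r ^ b) (k ^ r) {{m^n≢0 r b}} {{m^n≢0 k r}}}} ⟩
    r ^ b * k ^ r * c      ≡⟨ *-assoc (r ^ b) (k ^ r) c ⟩
    r ^ b * (k ^ r * c)    ≡⟨ n≡ ⟨
    n                      ∎
    where open ≤-Reasoning

  qkˢ≤n : q * k ^ s ≤ r ^ b * (k ^ r * c)
  qkˢ≤n = begin
    q * k ^ s             ≤⟨ *-mono-≤ (≤-trans (m≤m+n q N) (m≤m+n (q + N) (k * suc b))) (^-monoʳ-≤ k (m∸n≤m r (b + b))) ⟩
    c * k ^ r             ≡⟨ *-comm c (k ^ r) ⟩
    k ^ r * c             ≤⟨ m≤n*m (k ^ r * c) (r ^ b) {{m^n≢0 r b}} ⟩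
    r ^ b * (k ^ r * c)   ∎
    where open ≤-Reasoning

  few-non-neighbours : ∀ v → q * (1 + nonNeighbours (vertexAt v)) ≤ p * n
  few-non-neighbours v = *-cancelʳ-≤ (q * (1 + X)) (p * n) (k ^ s) {{m^n≢0 k s}} (begin
    q * (1 + X) * k ^ s                 ≤⟨ degree-arithmetic {q} {p} {X} {(k ∸ 1) ^ s} {k ^ s} {r ^ b} {c} {k ^ r}
                                             (subst (_≤ p * k ^ s) (+-comm 1 _) [1-1/k]ˢ<δ) qkˢ≤n
                                             (nonNeighbours-bound (vertexAt v)) ⟩
    p * (r ^ b * (k ^ r * c)) * k ^ s   ≡⟨ cong (λ t → p * t * k ^ s) n≡ ⟨
    p * n * k ^ s                       ∎)
    where
    open ≤-Reasoning
    X = nonNeighbours (vertexAt v)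

  degree : ∀ v → (1ℚ ℚ.- δ) ℚ.* ℕtoℚ n ℚ.≤ ℕtoℚ (deg G v)
  degree v = [1-δ]*n≤d {δ} {p} {q} δq≡p {n} {deg G v} (n≤deg+1+nonNeighbours v) (few-non-neighbours v)

  -- δ^(K−1) ≤ 2^(−10s) as soon as K − 1 ≥ 10(k+1), while the partial sums of eʳ stay below 2^(4r+1) ≤ 2^(10s).
  ceiling-bound : ∀ K → CeilRLog r δ K → K ≤ 10 * suc k
  ceiling-bound K ((M , 1<S*δʲ) , _) with 10 * suc k ≤? K ∸ 1
  ... | no small = ≤-trans (m≤n+m∸n K 1) (≰⇒> small)
  ... | yes large =
    ⊥-elim (ℚ.<-irrefl refl (ℚ.<-≤-trans 1<S*δʲ
      (*-≤-one S≤gap (^ℚ-nonNegative (ℚ.<⇒≤ 0<δ) j) (^ℚ*ℕtoℚ≤1 δq≡p j gap decay))))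
    where
    j = K ∸ 1
    gap = (2 ^ s) ^ 10
    decay : p ^ j * gap ≤ q ^ j
    decay = subst (λ t → p ^ t * gap ≤ q ^ t) (m+[n∸m]≡n large)
      (^-gap-iterate {p} {q} {suc k} {2 ^ s} (<⇒≤ p<q) (^[1+k]*2^≤^[1+k] {p} {q} {k} {s} 1≤k δ≤[1-1/[k+1]]ˢ) 10 (j ∸ 10 * suc k))
    S≤gap : expPartial r M ℚ.≤ ℕtoℚ gap
    S≤gap = ℚ.≤-trans (expPartial-bound r M) (ℕtoℚ-mono-≤ {2 * 2 ^ (4 * r)} {gap} (begin
      2 * 2 ^ (4 * r)   ≤⟨ ^-monoʳ-≤ 2 1+4r≤10s ⟩
      2 ^ (10 * s)      ≡⟨ cong (2 ^_) (*-comm 10 s) ⟩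
      2 ^ (s * 10)      ≡⟨ ^-*-assoc 2 s 10 ⟨
      gap                 ∎))
      where open ≤-Reasoning

  many-trees : ∀ K → CeilRLog r δ K → ∀ (ts : List (MonoTree G)) → Covers ts → r * K ≤ 120 * length ts
  many-trees K ceil ts cov =
    cover-arithmetic r<[1+b]*4 (ceiling-bound K ceil) 1≤k (cover-bound (m≤n+m (k * suc b) (q + N)) ts cov)

lemma3p8 : (r : ℕ) → 2 ≤ r → (δ : ℚ) → 0ℚ ℚ.< δ → δ ℚ.< 1ℚ →
    (N : ℕ) → Σ ℕ λ n → Σ (ColouredGraph r n) λ G →
      (N ≤ n)
      × (∀ v → (1ℚ ℚ.- δ) ℚ.* ℕtoℚ n ℚ.≤ ℕtoℚ (deg G v))
      × (∀ (k : ℕ) → CeilRLog r δ k →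
           ∀ (ts : List (MonoTree G)) → Covers ts → r * k ≤ 120 * length ts)
lemma3p8 r 2≤r δ 0<δ δ<1 N =
  let p , q , δq≡p , 1≤p , p<q = as-fraction δ 0<δ δ<1
      b = r / 4
      b*4≤r = m/n*n≤m r 4
      1≤s = 1≤r∸[b+b] {b} b*4≤r (≤-trans (s≤s z≤n) 2≤r)
      k , 1≤k , [1-1/k]ˢ<δ , δ≤[1-1/[k+1]]ˢ = threshold {s = r ∸ (b + b)} 1≤p p<q 1≤s
      open Witness r b 2≤r b*4≤r (r<[1+r/4]*4 r) δ 0<δ p q δq≡p p<q k 1≤k [1-1/k]ˢ<δ δ≤[1-1/[k+1]]ˢ N
  in n , G , N≤n , degree , many-trees
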